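{- The logic $\mathcal S'$ is algebraizable in the sense of Blok and Pigozzi with defining equation $\mathsf E(x)=\{x\approx 1\}$ and equivalence formulas $\Delta(x,y)=\{x\Rightarrow y,\ y\Rightarrow x\}$, and its equivalent algebraic semantics is the class of $\mathcal S'$-algebras.
   Context: $\mathcal S'$ is the sentential logic in the language $\langle\land,\lor,*,\Rightarrow,0,1\rangle$ of type $\langle2,2,2,2,0,0\rangle$ defined by the Hilbert-style calculus whose only rule is modus ponens (from $\varphi$ and $\varphi\Rightarrow\psi$ infer $\psi$) and whose axiom schemata are: (S1) $(\varphi\Rightarrow\psi)\Rightarrow((\psi\Rightarrow\gamma)\Rightarrow(\varphi\Rightarrow\gamma))$; (S2) $(\varphi\Rightarrow(\psi\Rightarrow\gamma))\Rightarrow(\psi\Rightarrow(\varphi\Rightarrow\gamma))$; (S3) $\varphi\Rightarrow(\psi\Rightarrow\varphi)$; (S4) $\varphi\Rightarrow(\psi\Rightarrow(\varphi*\psi))$; (S5) $(\varphi\Rightarrow(\psi\Rightarrow\gamma))\Rightarrow((\varphi*\psi)\Rightarrow\gamma)$; (S6) $(\varphi\land\psi)\Rightarrow\varphi$; (S7) $(\varphi\land\psi)\Rightarrow\psi$; (S8) $(\varphi\Rightarrow\psi)\Rightarrow((\varphi\Rightarrow\gamma)\Rightarrow(\varphi\Rightarrow(\psi\land\gamma)))$; (S9) $\varphi\Rightarrow(\varphi\lor\psi)$; (S10) $\psi\Rightarrow(\varphi\lor\psi)$; (S11) $(\varphi\Rightarrow\gamma)\Rightarrow((\psi\Rightarrow\gamma)\Rightarrow((\varphi\lor\psi)\Rightarrow\gamma))$;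 (S12) $1$; (S13) $0\Rightarrow\varphi$; (S14) $((\varphi\Rightarrow0)\Rightarrow0)\Rightarrow\varphi$; (S15) $(\varphi\Rightarrow(\varphi\Rightarrow(\varphi\Rightarrow\psi)))\Rightarrow(\varphi\Rightarrow(\varphi\Rightarrow\psi))$. A commutative integral residuated lattice (CIRL) is an algebra $\langle A,\land,\lor,*,\Rightarrow,1\rangle$ such that $\langle A,\land,\lor\rangle$ is a lattice with top element $1$, $\langle A,*,1\rangle$ is a commutative monoid, and $a*b\le c$ iff $b\le a\Rightarrow c$. A CIBRL is a CIRL with an extra constant $0$ that is the least element; set $\neg a:=a\Rightarrow0$. It is involutive if $\neg\neg x\approx x$, and three-potent if $a*a\le a*a*a$ for all $a$. An $\mathcal S'$-algebra is a three-potent involutive CIBRL. A logic $\vdash$ is algebraizable with defining equations $\mathsf E(x)$ and equivalence formulas $\Delta(x,y)$, with equivalent algebraic semantics a class $K$ of algebras, if for all sets of formulas $\Gamma\cup\{\varphi\}$: $\Gamma\vdash\varphi$ iff $\mathsf E(\Gamma)\models_K\mathsf E(\varphi)$, and $x\approx y$ and $\mathsf E(\Delta(x,y))$ are equationally interderivable over $K$ (here $\models_K$ is the equational consequence relation of $K$). -}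

module Defs where

open import Level using (0ℓ)
open import Data.Nat using (ℕ)
open import Data.Product using (_×_; _,_; proj₁; proj₂)
open import Data.Sum using (_⊎_)
open import Relation.Binary.Core using (Rel)
open import Relation.Binary.PropositionalEquality using (_≡_)
open import Algebra.Core using (Op₂)
open import Algebra.Definitions using (Congruent₂)
open import Algebra.Structures using (IsCommutativeMonoid)
open import Algebra.Lattice.Structures using (IsLattice)
open import Function.Bundles using (_⇔_)

infixr 5 _⟹_
infixl 7 _⊛_
infixl 6 _⋀_ _⋁_

data Fm : Set where
  var : ℕ → Fm
  _⋀_ _⋁_ _⊛_ _⟹_ : Fm → Fm → Fm
  𝟘 𝟙 : Fm

infix 3 _⊢_

data _⊢_ (Γ : Fm → Set) : Fm → Set where
  hyp : ∀ {φ} → Γ φ → Γ ⊢ φ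
  mp  : ∀ {φ ψ} → Γ ⊢ φ → Γ ⊢ (φ ⟹ ψ) → Γ ⊢ ψ
  S1  : ∀ φ ψ γ → Γ ⊢ (φ ⟹ ψ) ⟹ ((ψ ⟹ γ) ⟹ (φ ⟹ γ))
  S2  : ∀ φ ψ γ → Γ ⊢ (φ ⟹ (ψ ⟹ γ)) ⟹ (ψ ⟹ (φ ⟹ γ))
  S3  : ∀ φ ψ → Γ ⊢ φ ⟹ (ψ ⟹ φ)
  S4  : ∀ φ ψ → Γ ⊢ φ ⟹ (ψ ⟹ (φ ⊛ ψ))
  S5  : ∀ φ ψ γ → Γ ⊢ (φ ⟹ (ψ ⟹ γ)) ⟹ ((φ ⊛ ψ) ⟹ γ)
  S6  : ∀ φ ψ → Γ ⊢ (φ ⋀ ψ) ⟹ φ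
  S7  : ∀ φ ψ → Γ ⊢ (φ ⋀ ψ) ⟹ ψ
  S8  : ∀ φ ψ γ → Γ ⊢ (φ ⟹ ψ) ⟹ ((φ ⟹ γ) ⟹ (φ ⟹ (ψ ⋀ γ)))
  S9  : ∀ φ ψ → Γ ⊢ φ ⟹ (φ ⋁ ψ)
  S10 : ∀ φ ψ → Γ ⊢ ψ ⟹ (φ ⋁ ψ)
  S11 : ∀ φ ψ γ → Γ ⊢ (φ ⟹ γ) ⟹ ((ψ ⟹ γ) ⟹ ((φ ⋁ ψ) ⟹ γ))
  S12 : Γ ⊢ 𝟙
  S13 : ∀ φ → Γ ⊢ 𝟘 ⟹ φ
  S14 : ∀ φ → Γ ⊢ ((φ ⟹ 𝟘) ⟹ 𝟘) ⟹ φ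
  S15 : ∀ φ ψ → Γ ⊢ (φ ⟹ (φ ⟹ (φ ⟹ ψ))) ⟹ (φ ⟹ (φ ⟹ ψ))

-- S'-algebras: three-potent involutive CIBRLs (setoid-based).
-- Order: a ≤ b  iff  a ∧ b ≈ a.

record SAlg : Set₁ where
  infixl 7 _*_
  infixr 5 _⇒_
  infixl 6 _∧_ _∨_
  infix 4 _≈_
  field
    Carrier : Set
    _≈_ : Rel Carrier 0ℓ
    _∧_ _∨_ _*_ _⇒_ : Op₂ Carrier
    0# 1# : Carrier
    isLattice : IsLattice _≈_ _∨_ _∧_
    *-isCommutativeMonoid : IsCommutativeMonoid _≈_ _*_ 1#
    ⇒-cong : Congruent₂ _≈_ _⇒_
    top : ∀ a → a ∧ 1# ≈ a
    bottom : ∀ a → 0# ∧ a ≈ 0#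
    residuation : ∀ a b c → (a * b ∧ c ≈ a * b) ⇔ (b ∧ (a ⇒ c) ≈ b)
    involutive : ∀ a → (a ⇒ 0#) ⇒ 0# ≈ a
    three-potent : ∀ a → (a * a) ∧ (a * a * a) ≈ a * a

open SAlg public using (Carrier)

⟦_⟧ : Fm → (A : SAlg) → (ℕ → Carrier A) → Carrier A
⟦ var n ⟧ A v = v n
⟦ φ ⋀ ψ ⟧ A v = SAlg._∧_ A (⟦ φ ⟧ A v) (⟦ ψ ⟧ A v)
⟦ φ ⋁ ψ ⟧ A v = SAlg._∨_ A (⟦ φ ⟧ A v) (⟦ ψ ⟧ A v)
⟦ φ ⊛ ψ ⟧ A v = SAlg._*_ A (⟦ φ ⟧ A v) (⟦ ψ ⟧ A v)
⟦ φ ⟹ ψ ⟧ A v = SAlg._⇒_ A (⟦ φ ⟧ A v) (⟦ ψ ⟧ A v)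
⟦ 𝟘 ⟧ A v = SAlg.0# A
⟦ 𝟙 ⟧ A v = SAlg.1# A

Eqn : Set
Eqn = Fm × Fm

infix 3 _⊨K_

_⊨K_ : (Eqn → Set) → Eqn → Set₁
Θ ⊨K (s , t) =
  (A : SAlg) (v : ℕ → Carrier A) →
  (∀ e → Θ e → SAlg._≈_ A (⟦ proj₁ e ⟧ A v) (⟦ proj₂ e ⟧ A v)) →
  SAlg._≈_ A (⟦ s ⟧ A v) (⟦ t ⟧ A v)

E : (Fm → Set) → Eqn → Set
E Γ (s , t) = Γ s × (t ≡ 𝟙)

x y : Fm
x = var 0
y = var 1

x≈y : Eqn → Set
x≈y e = e ≡ (x , y)

EΔxy : Eqn → Set
EΔxy e = (e ≡ ((x ⟹ y) , 𝟙)) ⊎ (e ≡ ((y ⟹ x) , 𝟙))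

module Submission where

-- In every S'-algebra, a ⇒ b ≈ 1 holds exactly when a ≤ b;
--    with residuation this makes every axiom S1–S15 evaluate to 1, and
--    modus ponens preserves the value 1.  Hence Γ ⊢ φ gives E(Γ) ⊨ φ ≈ 1.
--  * Completeness.  For a fixed Γ, formulas modulo Γ-interderivability
--    (φ ∼ ψ iff Γ ⊢ φ ⟹ ψ and Γ ⊢ ψ ⟹ φ) form an S'-algebra, the
--    Lindenbaum algebra, whose lattice order is Γ-derivable implication.
--    Under the valuation var every formula evaluates to itself and every
--    member of Γ equals 1, so E(Γ) ⊨ φ ≈ 1 forces φ ∼ 𝟙, whence Γ ⊢ φ.
--  * The interderivability of x ≈ y and E(Δ(x,y)) is reflexivity of ⇒ and
--    antisymmetry of ≤, read through "a ⇒ b ≈ 1 iff a ≤ b".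

open import Defs
open import Level using (0ℓ)
open import Data.Product using (_×_; _,_; proj₁; proj₂)
open import Data.Sum using (inj₁; inj₂)
open import Function.Bundles using (_⇔_; mk⇔; Equivalence)
open import Relation.Binary.PropositionalEquality as ≡ using (_≡_; refl; cong₂; subst)
open import Relation.Binary.Bundles using (Poset)
open import Relation.Binary.Structures using (IsEquivalence)
open import Algebra.Bundles using (CommutativeMonoid)
open import Algebra.Structures using (IsCommutativeMonoid)
open import Algebra.Lattice.Bundles using (Lattice)
import Algebra.Lattice.Structures as LatticeStructures
import Algebra.Lattice.Properties.Lattice as LatticeProperties
import Algebra.Properties.CommutativeSemigroup as CommutativeSemigroupProperties
import Relation.Binary.Lattice.Structures as OrderLattice
import Relation.Binary.Reasoning.PartialOrder as PartialOrderReasoning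

module SAlgProperties (A : SAlg) where
  open SAlg A

  lattice : Lattice 0ℓ 0ℓ
  lattice = record { isLattice = isLattice }

  *-commutativeMonoid : CommutativeMonoid 0ℓ 0ℓ
  *-commutativeMonoid = record { isCommutativeMonoid = *-isCommutativeMonoid }

  open LatticeProperties lattice using (poset; ∨-∧-isOrderTheoreticLattice)
  open Poset poset public using (_≤_)
    renaming (refl to ≤-refl; trans to ≤-trans; antisym to ≤-antisym; reflexive to ≤-reflexive)
  open OrderLattice.IsLattice ∨-∧-isOrderTheoreticLattice public
    using (x≤x∨y; y≤x∨y; ∨-least; x∧y≤x; x∧y≤y; ∧-greatest)
  open CommutativeMonoid *-commutativeMonoid public
    using (assoc; comm; identityˡ; identityʳ)
  open CommutativeSemigroupProperties (CommutativeMonoid.commutativeSemigroup *-commutativeMonoid)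
    using (x∙yz≈y∙xz; xy∙z≈y∙xz)
  open LatticeStructures.IsLattice isLattice public
    using () renaming (refl to ≈-refl; sym to ≈-sym)
  open PartialOrderReasoning poset

  residual-intro : ∀ {a b c} → a * b ≤ c → b ≤ a ⇒ c
  residual-intro p = ≈-sym (Equivalence.to (residuation _ _ _) (≈-sym p))

  residual-elim : ∀ {a b c} → b ≤ a ⇒ c → a * b ≤ c
  residual-elim p = ≈-sym (Equivalence.from (residuation _ _ _) (≈-sym p))

  *-⇒-eval : ∀ {a b} → a * (a ⇒ b) ≤ b
  *-⇒-eval = residual-elim ≤-refl

  *-monoʳ : ∀ {a b b′} → b ≤ b′ → a * b ≤ a * b′
  *-monoʳ p = residual-elim (≤-trans p (residual-intro ≤-refl))

  *-monoˡ : ∀ {a a′ b} → a ≤ a′ → a * b ≤ a′ * b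
  *-monoˡ {a} {a′} {b} p = begin
    a * b   ≈⟨ comm a b ⟩
    b * a   ≤⟨ *-monoʳ p ⟩
    b * a′  ≈⟨ comm b a′ ⟩
    a′ * b  ∎

  ≤-top : ∀ {a} → a ≤ 1#
  ≤-top {a} = ≈-sym (top a)

  bottom-≤ : ∀ {a} → 0# ≤ a
  bottom-≤ {a} = ≈-sym (bottom a)

  -- Integrality: since 1 is the top and the unit, products decrease.
  *-decreasingʳ : ∀ {a b} → a * b ≤ b
  *-decreasingʳ {a} {b} = begin
    a * b   ≤⟨ *-monoˡ ≤-top ⟩
    1# * b  ≈⟨ identityˡ b ⟩
    b       ∎

  *-decreasingˡ : ∀ {a b} → a * b ≤ a
  *-decreasingˡ {a} {b} = ≤-trans (≤-reflexive (comm a b)) *-decreasingʳ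

  ≤⇒⇒≈1 : ∀ {a b} → a ≤ b → a ⇒ b ≈ 1#
  ≤⇒⇒≈1 {a} {b} p = ≤-antisym ≤-top (residual-intro (begin
    a * 1#  ≈⟨ identityʳ a ⟩
    a       ≤⟨ p ⟩
    b       ∎))

  ⇒≈1⇒≤ : ∀ {a b} → a ⇒ b ≈ 1# → a ≤ b
  ⇒≈1⇒≤ {a} {b} e = begin
    a       ≈⟨ ≈-sym (identityʳ a) ⟩
    a * 1#  ≤⟨ residual-elim (≤-reflexive (≈-sym e)) ⟩
    b       ∎

  residual-intro² : ∀ {a b c d} → c * (b * a) ≤ d → a ≤ b ⇒ (c ⇒ d)
  residual-intro² p = residual-intro (residual-intro p)

  S1-valid : ∀ a b c → (a ⇒ b) ⇒ ((b ⇒ c) ⇒ (a ⇒ c)) ≈ 1#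
  S1-valid a b c = ≤⇒⇒≈1 (residual-intro² (begin
    a * ((b ⇒ c) * (a ⇒ b))  ≈⟨ x∙yz≈y∙xz _ _ _ ⟩
    (b ⇒ c) * (a * (a ⇒ b))  ≤⟨ *-monoʳ *-⇒-eval ⟩
    (b ⇒ c) * b              ≈⟨ comm _ _ ⟩
    b * (b ⇒ c)              ≤⟨ *-⇒-eval ⟩
    c                        ∎))

  S2-valid : ∀ a b c → (a ⇒ (b ⇒ c)) ⇒ (b ⇒ (a ⇒ c)) ≈ 1#
  S2-valid a b c = ≤⇒⇒≈1 (residual-intro² (begin
    a * (b * (a ⇒ (b ⇒ c)))  ≈⟨ x∙yz≈y∙xz _ _ _ ⟩
    b * (a * (a ⇒ (b ⇒ c)))  ≤⟨ *-monoʳ *-⇒-eval ⟩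
    b * (b ⇒ c)              ≤⟨ *-⇒-eval ⟩
    c                        ∎))

  S3-valid : ∀ a b → a ⇒ (b ⇒ a) ≈ 1#
  S3-valid a b = ≤⇒⇒≈1 (residual-intro *-decreasingʳ)

  S4-valid : ∀ a b → a ⇒ (b ⇒ (a * b)) ≈ 1#
  S4-valid a b = ≤⇒⇒≈1 (residual-intro (≤-reflexive (comm b a)))

  S5-valid : ∀ a b c → (a ⇒ (b ⇒ c)) ⇒ ((a * b) ⇒ c) ≈ 1#
  S5-valid a b c = ≤⇒⇒≈1 (residual-intro (begin
    (a * b) * (a ⇒ (b ⇒ c))  ≈⟨ xy∙z≈y∙xz _ _ _ ⟩
    b * (a * (a ⇒ (b ⇒ c)))  ≤⟨ *-monoʳ *-⇒-eval ⟩
    b * (b ⇒ c)              ≤⟨ *-⇒-eval ⟩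
    c                        ∎))

  S8-valid : ∀ a b c → (a ⇒ b) ⇒ ((a ⇒ c) ⇒ (a ⇒ (b ∧ c))) ≈ 1#
  S8-valid a b c = ≤⇒⇒≈1 (residual-intro² (∧-greatest
    (begin
      a * ((a ⇒ c) * (a ⇒ b))  ≤⟨ *-monoʳ *-decreasingʳ ⟩
      a * (a ⇒ b)              ≤⟨ *-⇒-eval ⟩
      b                        ∎)
    (begin
      a * ((a ⇒ c) * (a ⇒ b))  ≤⟨ *-monoʳ *-decreasingˡ ⟩
      a * (a ⇒ c)              ≤⟨ *-⇒-eval ⟩
      c                        ∎)))

  -- For S11 the join is eliminated on the residual side:
  -- a ∨ b ≤ q ⇒ c with q = (b ⇒ c) * (a ⇒ c), since both a and b are.
  S11-valid : ∀ a b c → (a ⇒ c) ⇒ ((b ⇒ c) ⇒ ((a ∨ b) ⇒ c)) ≈ 1#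
  S11-valid a b c = ≤⇒⇒≈1 (residual-intro (residual-intro (begin
    (a ∨ b) * ((b ⇒ c) * (a ⇒ c))  ≈⟨ comm _ _ ⟩
    ((b ⇒ c) * (a ⇒ c)) * (a ∨ b)  ≤⟨ residual-elim (∨-least (residual-intro sends-a) (residual-intro sends-b)) ⟩
    c                              ∎)))
    where
    sends-a : ((b ⇒ c) * (a ⇒ c)) * a ≤ c
    sends-a = begin
      ((b ⇒ c) * (a ⇒ c)) * a  ≤⟨ *-monoˡ *-decreasingʳ ⟩
      (a ⇒ c) * a              ≈⟨ comm _ _ ⟩
      a * (a ⇒ c)              ≤⟨ *-⇒-eval ⟩
      c                        ∎
    sends-b : ((b ⇒ c) * (a ⇒ c)) * b ≤ c
    sends-b = begin
      ((b ⇒ c) * (a ⇒ c)) * b  ≤⟨ *-monoˡ *-decreasingˡ ⟩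
      (b ⇒ c) * b              ≈⟨ comm _ _ ⟩
      b * (b ⇒ c)              ≤⟨ *-⇒-eval ⟩
      c                        ∎

  -- S15 is exactly where three-potency (a * a ≤ a * a * a) is used.
  S15-valid : ∀ a b → (a ⇒ (a ⇒ (a ⇒ b))) ⇒ (a ⇒ (a ⇒ b)) ≈ 1#
  S15-valid a b = ≤⇒⇒≈1 (residual-intro² (begin
    a * (a * h)              ≈⟨ ≈-sym (assoc _ _ _) ⟩
    (a * a) * h              ≤⟨ *-monoˡ (≈-sym (three-potent a)) ⟩
    ((a * a) * a) * h        ≈⟨ assoc _ _ _ ⟩
    (a * a) * (a * h)        ≈⟨ assoc _ _ _ ⟩
    a * (a * (a * h))        ≤⟨ *-monoʳ (*-monoʳ *-⇒-eval) ⟩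
    a * (a * (a ⇒ (a ⇒ b)))  ≤⟨ *-monoʳ *-⇒-eval ⟩
    a * (a ⇒ b)              ≤⟨ *-⇒-eval ⟩
    b                        ∎))
    where h = a ⇒ (a ⇒ (a ⇒ b))

  mp-valid : ∀ {a b} → a ≈ 1# → a ⇒ b ≈ 1# → b ≈ 1#
  mp-valid {a} {b} e f = ≤-antisym ≤-top (≤-trans (≤-reflexive (≈-sym e)) (⇒≈1⇒≤ f))

  ≈⇒⇒≈1 : ∀ {a b} → a ≈ b → a ⇒ b ≈ 1#
  ≈⇒⇒≈1 e = ≤⇒⇒≈1 (≤-reflexive e)

  ⇒≈1-antisym : ∀ {a b} → a ⇒ b ≈ 1# → b ⇒ a ≈ 1# → a ≈ b
  ⇒≈1-antisym e f = ≤-antisym (⇒≈1⇒≤ e) (⇒≈1⇒≤ f)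

soundness : ∀ {Γ φ} → Γ ⊢ φ → E Γ ⊨K (φ , 𝟙)
soundness (hyp g)       A v h = h (_ , 𝟙) (g , refl)
soundness (mp d e)      A v h = SAlgProperties.mp-valid A (soundness d A v h) (soundness e A v h)
soundness (S1 φ ψ γ)    A v h = SAlgProperties.S1-valid A _ _ _
soundness (S2 φ ψ γ)    A v h = SAlgProperties.S2-valid A _ _ _
soundness (S3 φ ψ)      A v h = SAlgProperties.S3-valid A _ _
soundness (S4 φ ψ)      A v h = SAlgProperties.S4-valid A _ _
soundness (S5 φ ψ γ)    A v h = SAlgProperties.S5-valid A _ _ _
soundness (S6 φ ψ)      A v h = SAlgProperties.≤⇒⇒≈1 A (SAlgProperties.x∧y≤x A _ _)
soundness (S7 φ ψ)      A v h = SAlgProperties.≤⇒⇒≈1 A (SAlgProperties.x∧y≤y A _ _)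
soundness (S8 φ ψ γ)    A v h = SAlgProperties.S8-valid A _ _ _
soundness (S9 φ ψ)      A v h = SAlgProperties.≤⇒⇒≈1 A (SAlgProperties.x≤x∨y A _ _)
soundness (S10 φ ψ)     A v h = SAlgProperties.≤⇒⇒≈1 A (SAlgProperties.y≤x∨y A _ _)
soundness (S11 φ ψ γ)   A v h = SAlgProperties.S11-valid A _ _ _
soundness S12           A v h = SAlgProperties.≈-refl A
soundness (S13 φ)       A v h = SAlgProperties.≤⇒⇒≈1 A (SAlgProperties.bottom-≤ A)
soundness (S14 φ)       A v h = SAlgProperties.≤⇒⇒≈1 A (SAlgProperties.≤-reflexive A (SAlg.involutive A _))
soundness (S15 φ ψ)     A v h = SAlgProperties.S15-valid A _ _

module DerivedRules (Γ : Fm → Set) where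

  weaken : ∀ {a b} → Γ ⊢ a → Γ ⊢ b ⟹ a
  weaken p = mp p (S3 _ _)

  exchange : ∀ {a b c} → Γ ⊢ a ⟹ (b ⟹ c) → Γ ⊢ b ⟹ (a ⟹ c)
  exchange p = mp p (S2 _ _ _)

  ⟹-trans : ∀ {a b c} → Γ ⊢ a ⟹ b → Γ ⊢ b ⟹ c → Γ ⊢ a ⟹ c
  ⟹-trans p q = mp q (mp p (S1 _ _ _))

  ⟹-refl : ∀ {a} → Γ ⊢ a ⟹ a
  ⟹-refl {a} = mp S12 (exchange (S3 a 𝟙))

  ⟹-monoʳ : ∀ {a b c} → Γ ⊢ b ⟹ c → Γ ⊢ (a ⟹ b) ⟹ (a ⟹ c)
  ⟹-monoʳ p = mp p (exchange (S1 _ _ _))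

  ⟹-antiˡ : ∀ {a b c} → Γ ⊢ a ⟹ b → Γ ⊢ (b ⟹ c) ⟹ (a ⟹ c)
  ⟹-antiˡ p = mp p (S1 _ _ _)

  uncurry : ∀ {a b c} → Γ ⊢ a ⟹ (b ⟹ c) → Γ ⊢ (a ⊛ b) ⟹ c
  uncurry p = mp p (S5 _ _ _)

  curry : ∀ {a b c} → Γ ⊢ (a ⊛ b) ⟹ c → Γ ⊢ a ⟹ (b ⟹ c)
  curry p = ⟹-trans (S4 _ _) (⟹-monoʳ p)

  ⋀-intro : ∀ {a b c} → Γ ⊢ a ⟹ b → Γ ⊢ a ⟹ c → Γ ⊢ a ⟹ (b ⋀ c)
  ⋀-intro p q = mp q (mp p (S8 _ _ _))

  ⋁-elim : ∀ {a b c} → Γ ⊢ a ⟹ c → Γ ⊢ b ⟹ c → Γ ⊢ (a ⋁ b) ⟹ c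
  ⋁-elim p q = mp q (mp p (S11 _ _ _))

  ⊛-comm : ∀ {a b} → Γ ⊢ (a ⊛ b) ⟹ (b ⊛ a)
  ⊛-comm = uncurry (exchange (S4 _ _))

  ⊛-assocʳ : ∀ {a b c} → Γ ⊢ ((a ⊛ b) ⊛ c) ⟹ (a ⊛ (b ⊛ c))
  ⊛-assocʳ {a} {b} {c} =
    uncurry (uncurry (exchange (mp (curry (exchange (S4 a (b ⊛ c)))) (⟹-monoʳ (S2 c a _)))))

  ⊛-assocˡ : ∀ {a b c} → Γ ⊢ (a ⊛ (b ⊛ c)) ⟹ ((a ⊛ b) ⊛ c)
  ⊛-assocˡ {a} {b} {c} =
    uncurry (exchange (uncurry (mp (exchange (curry (curry ⟹-refl))) (⟹-monoʳ (S2 a c _)))))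

  ⊛-cong : ∀ {a a′ b b′} → Γ ⊢ a ⟹ a′ → Γ ⊢ b ⟹ b′ → Γ ⊢ (a ⊛ b) ⟹ (a′ ⊛ b′)
  ⊛-cong p q = uncurry (⟹-trans p (⟹-trans (S4 _ _) (⟹-antiˡ q)))

module Lindenbaum (Γ : Fm → Set) where
  open DerivedRules Γ

  infix 4 _∼_
  _∼_ : Fm → Fm → Set
  a ∼ b = (Γ ⊢ a ⟹ b) × (Γ ⊢ b ⟹ a)

  ∼-isEquivalence : IsEquivalence _∼_
  ∼-isEquivalence = record
    { refl  = ⟹-refl , ⟹-refl
    ; sym   = λ (p , q) → q , p
    ; trans = λ (p , q) (r , s) → ⟹-trans p r , ⟹-trans s q
    }

  ⊢⟹-as-order : ∀ {a b} → Γ ⊢ a ⟹ b → (a ⋀ b) ∼ a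
  ⊢⟹-as-order p = S6 _ _ , ⋀-intro ⟹-refl p

  order-as-⊢⟹ : ∀ {a b} → (a ⋀ b) ∼ a → Γ ⊢ a ⟹ b
  order-as-⊢⟹ (_ , q) = ⟹-trans q (S7 _ _)

  isLattice : LatticeStructures.IsLattice _∼_ _⋁_ _⋀_
  isLattice = record
    { isEquivalence = ∼-isEquivalence
    ; ∨-comm  = λ a b → ⋁-swap , ⋁-swap
    ; ∨-assoc = λ a b c →
        ⋁-elim (⋁-elim (S9 _ _) (⟹-trans (S9 _ _) (S10 _ _))) (⟹-trans (S10 _ _) (S10 _ _))
      , ⋁-elim (⟹-trans (S9 _ _) (S9 _ _)) (⋁-elim (⟹-trans (S10 _ _) (S9 _ _)) (S10 _ _))
    ; ∨-cong  = λ (p , q) (r , s) → ⋁-mono p r , ⋁-mono q s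
    ; ∧-comm  = λ a b → ⋀-swap , ⋀-swap
    ; ∧-assoc = λ a b c →
        ⋀-intro (⟹-trans (S6 _ _) (S6 _ _)) (⋀-intro (⟹-trans (S6 _ _) (S7 _ _)) (S7 _ _))
      , ⋀-intro (⋀-intro (S6 _ _) (⟹-trans (S7 _ _) (S6 _ _))) (⟹-trans (S7 _ _) (S7 _ _))
    ; ∧-cong  = λ (p , q) (r , s) → ⋀-mono p r , ⋀-mono q s
    ; absorptive = (λ a b → ⋁-elim ⟹-refl (S6 _ _) , S9 _ _)
                 , (λ a b → S6 _ _ , ⋀-intro ⟹-refl (S9 _ _))
    }
    where
    ⋁-swap : ∀ {a b} → Γ ⊢ (a ⋁ b) ⟹ (b ⋁ a)
    ⋁-swap = ⋁-elim (S10 _ _) (S9 _ _)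
    ⋀-swap : ∀ {a b} → Γ ⊢ (a ⋀ b) ⟹ (b ⋀ a)
    ⋀-swap = ⋀-intro (S7 _ _) (S6 _ _)
    ⋁-mono : ∀ {a a′ b b′} → Γ ⊢ a ⟹ a′ → Γ ⊢ b ⟹ b′ → Γ ⊢ (a ⋁ b) ⟹ (a′ ⋁ b′)
    ⋁-mono p q = ⋁-elim (⟹-trans p (S9 _ _)) (⟹-trans q (S10 _ _))
    ⋀-mono : ∀ {a a′ b b′} → Γ ⊢ a ⟹ a′ → Γ ⊢ b ⟹ b′ → Γ ⊢ (a ⋀ b) ⟹ (a′ ⋀ b′)
    ⋀-mono p q = ⋀-intro (⟹-trans (S6 _ _) p) (⟹-trans (S7 _ _) q)

  ⊛-isCommutativeMonoid : IsCommutativeMonoid _∼_ _⊛_ 𝟙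
  ⊛-isCommutativeMonoid = record
    { isMonoid = record
      { isSemigroup = record
        { isMagma = record
          { isEquivalence = ∼-isEquivalence
          ; ∙-cong = λ (p , q) (r , s) → ⊛-cong p r , ⊛-cong q s
          }
        ; assoc = λ a b c → ⊛-assocʳ , ⊛-assocˡ
        }
      ; identity = (λ a → uncurry (weaken ⟹-refl) , mp S12 (S4 𝟙 a))
                 , (λ a → uncurry (S3 _ _) , mp S12 (exchange (S4 a 𝟙)))
      }
    ; comm = λ a b → ⊛-comm , ⊛-comm
    }

  ⊛-three-potent : ∀ a → Γ ⊢ (a ⊛ a) ⟹ ((a ⊛ a) ⊛ a)
  ⊛-three-potent a = uncurry (mp (curry (curry ⟹-refl)) (S15 a _))

  lindenbaum : SAlg
  lindenbaum = record
    { Carrier = Fm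
    ; _≈_ = _∼_
    ; _∧_ = _⋀_ ; _∨_ = _⋁_ ; _*_ = _⊛_ ; _⇒_ = _⟹_ ; 0# = 𝟘 ; 1# = 𝟙
    ; isLattice = isLattice
    ; *-isCommutativeMonoid = ⊛-isCommutativeMonoid
    ; ⇒-cong = λ (p , q) (r , s) → ⟹-trans (⟹-antiˡ q) (⟹-monoʳ r) , ⟹-trans (⟹-antiˡ p) (⟹-monoʳ s)
    ; top = λ a → ⊢⟹-as-order (weaken S12)
    ; bottom = λ a → ⊢⟹-as-order (S13 a)
    ; residuation = λ a b c → mk⇔
        (λ h → ⊢⟹-as-order (exchange (curry (order-as-⊢⟹ h))))
        (λ h → ⊢⟹-as-order (uncurry (exchange (order-as-⊢⟹ h))))
    ; involutive = λ a → S14 a , exchange ⟹-refl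
    ; three-potent = λ a → ⊢⟹-as-order (⊛-three-potent a)
    }

  eval-canonical : ∀ φ → ⟦ φ ⟧ lindenbaum var ≡ φ
  eval-canonical (var n) = refl
  eval-canonical (φ ⋀ ψ) = cong₂ _⋀_ (eval-canonical φ) (eval-canonical ψ)
  eval-canonical (φ ⋁ ψ) = cong₂ _⋁_ (eval-canonical φ) (eval-canonical ψ)
  eval-canonical (φ ⊛ ψ) = cong₂ _⊛_ (eval-canonical φ) (eval-canonical ψ)
  eval-canonical (φ ⟹ ψ) = cong₂ _⟹_ (eval-canonical φ) (eval-canonical ψ)
  eval-canonical 𝟘 = refl
  eval-canonical 𝟙 = refl

  canonical-satisfies-E : ∀ e → E Γ e → ⟦ proj₁ e ⟧ lindenbaum var ∼ ⟦ proj₂ e ⟧ lindenbaum var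
  canonical-satisfies-E (s , .𝟙) (g , refl) =
    subst (_∼ 𝟙) (≡.sym (eval-canonical s)) (weaken S12 , weaken (hyp g))

completeness : ∀ {Γ φ} → E Γ ⊨K (φ , 𝟙) → Γ ⊢ φ
completeness {Γ} {φ} h =
  mp S12 (subst (λ t → Γ ⊢ 𝟙 ⟹ t) (eval-canonical φ) (proj₂ (h lindenbaum var canonical-satisfies-E)))
  where open Lindenbaum Γ

theorem4p2 : (∀ (Γ : Fm → Set) (φ : Fm) → (Γ ⊢ φ) ⇔ (E Γ ⊨K (φ , 𝟙)))
    × ((∀ e → EΔxy e → x≈y ⊨K e) × (EΔxy ⊨K (x , y)))
theorem4p2 = (λ Γ φ → mk⇔ soundness completeness) , x≈y⊨EΔ , EΔ⊨x≈y
  where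
  x≈y⊨EΔ : ∀ e → EΔxy e → x≈y ⊨K e
  x≈y⊨EΔ _ (inj₁ refl) A v h = SAlgProperties.≈⇒⇒≈1 A (h _ refl)
  x≈y⊨EΔ _ (inj₂ refl) A v h = SAlgProperties.≈⇒⇒≈1 A (SAlgProperties.≈-sym A (h _ refl))

  EΔ⊨x≈y : EΔxy ⊨K (x , y)
  EΔ⊨x≈y A v h = SAlgProperties.⇒≈1-antisym A (h _ (inj₁ refl)) (h _ (inj₂ refl))
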